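{- For every integer $k \ge 1$, every outer $k$-planar drawing of a maximal outer $k$-planar graph admits a triangulation of the outer cycle with edge piercing number at most $2k-1$.
   Context: A convex drawing of a finite simple graph $G$ places the vertices at distinct points of a circle and draws every edge as a straight-line segment; it is outer $k$-planar if every edge crosses at most $k$ other edges. $G$ is outer $k$-planar if it has such a drawing, and maximal outer $k$-planar if it is outer $k$-planar and adding any non-adjacent vertex pair as an edge yields a graph that is not outer $k$-planar. Given a convex drawing with counterclockwise cyclic vertex order $v_1,\dots,v_n$, two pairs of four distinct vertices are intertwined if their vertices alternate in the cyclic order. The outer cycle is the cycle $v_1v_2\cdots v_nv_1$ (regardless of whether these pairs are edges of $G$). A triangulation of the outer cycle is a set of vertex pairs, called links, consisting of the $n$ outer links $\{v_t,v_{t+1}\}$ (indices mod $n$) together with $n-3$ pairwise non-intertwined pairs of non-consecutive vertices (inner links), so that the links form a triangulated $n$-gon. A link is pierced by an edge of $G$ if the link and the edge are intertwined; the piercing number of a link is the number of edges of $G$ piercing it; the edge piercing number of the triangulation is the maximum piercing number over its links. -}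

module Defs where

open import Data.Bool using (Bool; true; false; _∧_; _∨_; not; if_then_else_)
open import Data.Nat using (ℕ; zero; suc; _≤_; _<_; _∸_; _+_) renaming (_<ᵇ_ to _<ᵇ_; _≡ᵇ_ to _==_)
open import Data.Fin using (Fin; toℕ)
open import Data.Fin.Permutation using (Permutation′; _⟨$⟩ʳ_)
open import Data.List using (List; []; _∷_; map; allFin; cartesianProduct; filter; length; _++_)
open import Data.List.Relation.Unary.All using (All)
open import Data.List.Relation.Unary.AllPairs using (AllPairs)
open import Data.List.Relation.Unary.Unique.Propositional using (Unique)
open import Data.Product using (_×_; _,_; proj₁; proj₂; Σ; ∃)
open import Relation.Binary.PropositionalEquality using (_≡_; _≢_)
open import Relation.Nullary using (¬_)

record SimpleGraph (n : ℕ) : Set where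
  field
    adj     : Fin n → Fin n → Bool
    adj-sym : ∀ u v → adj u v ≡ adj v u
    irrefl  : ∀ v → adj v v ≡ false
open SimpleGraph public

_=ᶠ_ : ∀ {n} → Fin n → Fin n → Bool
i =ᶠ j = toℕ i == toℕ j

strictlyBetween : ℕ → ℕ → ℕ → Bool
strictlyBetween p q r =
  ((p <ᵇ r) ∧ (r <ᵇ q)) ∨ ((q <ᵇ r) ∧ (r <ᵇ p))

-- Positions p,q,r,s on the circle (points 0,...,n-1 in cyclic order).
-- The pairs {p,q} and {r,s} are intertwined iff the four points are
-- distinct and alternate in the cyclic order, i.e. exactly one of r,s
-- lies strictly between p and q in the linear order 0 < 1 < ... < n-1.
distinct4 : ℕ → ℕ → ℕ → ℕ → Bool
distinct4 p q r s =
  not (p == q) ∧ not (p == r) ∧ not (p == s) ∧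
  not (q == r) ∧ not (q == s) ∧ not (r == s)

xorB : Bool → Bool → Bool
xorB true b = not b
xorB false b = b

intertwinedℕ : ℕ → ℕ → ℕ → ℕ → Bool
intertwinedℕ p q r s =
  distinct4 p q r s ∧ xorB (strictlyBetween p q r) (strictlyBetween p q s)

intertwined : ∀ {n} → Fin n → Fin n → Fin n → Fin n → Bool
intertwined p q r s = intertwinedℕ (toℕ p) (toℕ q) (toℕ r) (toℕ s)

countB : ∀ {A : Set} → (A → Bool) → List A → ℕ
countB f [] = 0
countB f (x ∷ xs) = if f x then suc (countB f xs) else countB f xs

orderedPairs : ∀ n → List (Fin n × Fin n)
orderedPairs n = filter (λ cd → toℕ (proj₁ cd) Data.Nat.<? toℕ (proj₂ cd))
                        (cartesianProduct (allFin n) (allFin n))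

-- Adjacency relations, possibly not simple (used for "G + uv").
Adj : ℕ → Set
Adj n = Fin n → Fin n → Bool

-- A convex drawing of a graph on Fin n is given by a bijection π from the
-- vertices to the n points of the circle, numbered 0,...,n-1 in
-- counterclockwise order.
Drawing : ℕ → Set
Drawing n = Permutation′ n

crossings : ∀ {n} → Adj n → Drawing n → Fin n → Fin n → ℕ
crossings {n} E π a b =
  countB (λ cd → E (proj₁ cd) (proj₂ cd) ∧
                 intertwined (π ⟨$⟩ʳ a) (π ⟨$⟩ʳ b) (π ⟨$⟩ʳ proj₁ cd) (π ⟨$⟩ʳ proj₂ cd))
         (orderedPairs n)

IsOuterKPlanarDrawing : ∀ {n} → ℕ → Adj n → Drawing n → Set
IsOuterKPlanarDrawing k E π = ∀ a b → E a b ≡ true → crossings E π a b ≤ k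

IsOuterKPlanar : ∀ {n} → ℕ → Adj n → Set
IsOuterKPlanar {n} k E = ∃ λ (π : Drawing n) → IsOuterKPlanarDrawing k E π

addEdge : ∀ {n} → Adj n → Fin n → Fin n → Adj n
addEdge E u v x y = E x y ∨ ((x =ᶠ u) ∧ (y =ᶠ v)) ∨ ((x =ᶠ v) ∧ (y =ᶠ u))

IsMaximalOuterKPlanar : ∀ {n} → ℕ → SimpleGraph n → Set
IsMaximalOuterKPlanar k G =
  IsOuterKPlanar k (adj G) ×
  (∀ u v → u ≢ v → adj G u v ≡ false → ¬ IsOuterKPlanar k (addEdge (adj G) u v))

-- Links are pairs of circle positions (Fin n).
Link : ℕ → Set
Link n = Fin n × Fin n

consecutive : ∀ {n} → Fin n → Fin n → Bool
consecutive {n} i j =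
  (suc (toℕ i) == toℕ j) ∨ (suc (toℕ j) == toℕ i) ∨
  ((suc (toℕ i) == n) ∧ (toℕ j == 0)) ∨ ((suc (toℕ j) == n) ∧ (toℕ i == 0))

nextPos : ∀ {n} → Fin n → Fin n
nextPos {suc m} i with toℕ i Data.Nat.<? m
... | Relation.Nullary.yes i<m = Data.Fin.fromℕ< {suc (toℕ i)} (Data.Nat.s≤s i<m)
... | Relation.Nullary.no  _   = Data.Fin.zero

outerLinks : ∀ n → List (Link n)
outerLinks n = map (λ i → i , nextPos i) (allFin n)

record Triangulation (n : ℕ) : Set where
  field
    innerLinks    : List (Link n)
    count-inner   : length innerLinks ≡ n ∸ 3
    distinct      : Unique innerLinks
    ordered       : All (λ l → toℕ (proj₁ l) < toℕ (proj₂ l)) innerLinks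
    nonConsec     : All (λ l → consecutive (proj₁ l) (proj₂ l) ≡ false) innerLinks
    nonCrossing   : AllPairs (λ l m → intertwined (proj₁ l) (proj₂ l) (proj₁ m) (proj₂ m) ≡ false)
                             innerLinks
open Triangulation public

links : ∀ {n} → Triangulation n → List (Link n)
links {n} T = outerLinks n ++ innerLinks T

piercing : ∀ {n} → Adj n → Drawing n → Link n → ℕ
piercing {n} E π (p , q) =
  countB (λ cd → E (proj₁ cd) (proj₂ cd) ∧
                 intertwined p q (π ⟨$⟩ʳ proj₁ cd) (π ⟨$⟩ʳ proj₂ cd))
         (orderedPairs n)

EdgePiercingAtMost : ∀ {n} → Adj n → Drawing n → Triangulation n → ℕ → Set
EdgePiercingAtMost E π T m = All (λ l → piercing E π l ≤ m) (links T)

-- Triangulate an interval [i, j] of circle positions recursively, splitting it at some x with i < x < j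
-- while keeping every link pierced at most 2k − 1 times; the root link {0, n − 1}, like every outer link,
-- is pierced by nothing. If 1 ≤ p ≤ 2k − 1 edges pierce {i, j}, each has exactly one end strictly inside;
-- order them by that end and split at the inner end x of a median edge e. An edge piercing {i, x} either
-- pierces {i, j} on the near side of e (at most k − 1 such edges) or crosses e (at most k). If nothing
-- pierces {i, j}, split at an inner end of a maximal chord e nested in {i, j} (at i + 1 if there is none):
-- then only edges crossing e can pierce the halves.
--
-- Each fact about the relative position of at most six points on the circle is a quantifier-free
-- formula in the order of naturals, decided by evaluating it on all order types.
module Submission where

open import Defs
open import Data.Bool using (Bool; true; false; _∧_; _∨_; not; if_then_else_)
open import Data.Bool.Properties using (∧-zeroʳ; ∨-zeroʳ)
open import Data.Empty using (⊥-elim)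
open import Data.Fin as Fin using (Fin; toℕ; fromℕ<)
open import Data.Fin.Permutation using (_⟨$⟩ʳ_)
open import Data.Fin.Properties using (toℕ-fromℕ<; toℕ-fromℕ; toℕ<n)
open import Data.List using (List; []; _∷_; _++_; length; allFin)
open import Data.List.Membership.Propositional using (_∈_; find)
open import Data.List.Membership.Propositional.Properties using (∈-allFin)
open import Data.List.Properties using (length-tabulate; length-++)
open import Data.List.Relation.Unary.Any using (Any; here; there)
open import Data.List.Relation.Unary.All as All using (All; []; _∷_)
open import Data.List.Relation.Unary.All.Properties as All using (++⁺)
open import Data.List.Relation.Unary.AllPairs as AllPairs using (AllPairs; []; _∷_)
open import Data.List.Relation.Unary.AllPairs.Properties as AllPairs using ()
open import Data.Nat using (ℕ; zero; suc; _+_; _*_; _∸_; _≤_; _<_; _<ᵇ_; _≡ᵇ_; z≤n; s≤s; _<?_; _≤?_)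
open import Data.Nat.Induction using (<-wellFounded)
open import Data.Nat.Properties
open import Data.Product using (∃; _×_; _,_; proj₁; proj₂)
open import Data.Sum using (_⊎_; inj₁; inj₂)
open import Data.Vec using (Vec; []; _∷_; lookup; tabulate)
import Data.Vec as Vec
open import Data.Vec.Properties using (lookup-map; lookup∘tabulate)
open import Function using (_∘_; id)
open import Induction.WellFounded using (Acc; acc)
open import Relation.Binary using (tri<; tri≈; tri>)
open import Relation.Binary.PropositionalEquality
open import Relation.Nullary using (yes; no)

∧-intro : ∀ {a b} → a ≡ true → b ≡ true → a ∧ b ≡ true
∧-intro refl refl = refl

∧-true⁻ : ∀ {a b} → a ∧ b ≡ true → a ≡ true × b ≡ true
∧-true⁻ {true} p = refl , p

∨-true⁻ : ∀ {a b} → a ∨ b ≡ true → a ≡ true ⊎ b ≡ true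
∨-true⁻ {true}  _ = inj₁ refl
∨-true⁻ {false} p = inj₂ p

∨-introˡ : ∀ {a b} → a ≡ true → a ∨ b ≡ true
∨-introˡ refl = refl

∨-introʳ : ∀ {a b} → b ≡ true → a ∨ b ≡ true
∨-introʳ {a} refl = ∨-zeroʳ a

⇒-elim : ∀ {a b} → not a ∨ b ≡ true → a ≡ true → b ≡ true
⇒-elim p refl = p

not-true⁻ : ∀ {a} → not a ≡ true → a ≡ false
not-true⁻ {false} _ = refl

contradictionᵇ : ∀ {a} → a ≡ true → a ≡ false → ∀ {A : Set} → A
contradictionᵇ refl ()

<ᵇ-true⁺ : ∀ {m n} → m < n → (m <ᵇ n) ≡ true
<ᵇ-true⁺ {zero}  {suc n} _       = refl
<ᵇ-true⁺ {suc m} {suc n} (s≤s p) = <ᵇ-true⁺ p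

<ᵇ-true⁻ : ∀ {m n} → (m <ᵇ n) ≡ true → m < n
<ᵇ-true⁻ {zero}  {suc n} _ = s≤s z≤n
<ᵇ-true⁻ {suc m} {suc n} p = s≤s (<ᵇ-true⁻ p)

<ᵇ-false⁺ : ∀ {m n} → n ≤ m → (m <ᵇ n) ≡ false
<ᵇ-false⁺ z≤n     = refl
<ᵇ-false⁺ (s≤s p) = <ᵇ-false⁺ p

≡ᵇ-true⁺ : ∀ {m n} → m ≡ n → (m ≡ᵇ n) ≡ true
≡ᵇ-true⁺ {zero}  refl = refl
≡ᵇ-true⁺ {suc m} refl = ≡ᵇ-true⁺ {m} refl

≡ᵇ-false⁺ : ∀ {m n} → m ≢ n → (m ≡ᵇ n) ≡ false
≡ᵇ-false⁺ {zero}  {zero}  p = ⊥-elim (p refl)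
≡ᵇ-false⁺ {zero}  {suc n} p = refl
≡ᵇ-false⁺ {suc m} {zero}  p = refl
≡ᵇ-false⁺ {suc m} {suc n} p = ≡ᵇ-false⁺ (p ∘ cong suc)

module _ {A : Set} where

  countB-cong : ∀ {P Q : A → Bool} (xs : List A) →
                (∀ {x} → x ∈ xs → P x ≡ Q x) → countB P xs ≡ countB Q xs
  countB-cong          []       eq = refl
  countB-cong {Q = Q} (x ∷ xs) eq rewrite eq (here refl) =
    cong (λ c → if Q x then suc c else c) (countB-cong xs (eq ∘ there))

  countB-mono : ∀ {P Q : A → Bool} (xs : List A) →
                (∀ {x} → x ∈ xs → P x ≡ true → Q x ≡ true) → countB P xs ≤ countB Q xs
  countB-mono []       P⇒Q = z≤n
  countB-mono {P} {Q} (x ∷ xs) P⇒Q with P x in Px | Q x in Qx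
  ... | true  | true  = s≤s (countB-mono xs (P⇒Q ∘ there))
  ... | true  | false = contradictionᵇ (P⇒Q (here refl) Px) Qx
  ... | false | true  = m≤n⇒m≤1+n (countB-mono xs (P⇒Q ∘ there))
  ... | false | false = countB-mono xs (P⇒Q ∘ there)

  countB-∨ : ∀ (Q R : A → Bool) (xs : List A) →
             countB (λ x → Q x ∨ R x) xs ≤ countB Q xs + countB R xs
  countB-∨ Q R []       = z≤n
  countB-∨ Q R (x ∷ xs) with Q x | R x | countB-∨ Q R xs
  ... | true  | true  | ih = s≤s (≤-trans ih (+-monoʳ-≤ _ (n≤1+n _)))
  ... | true  | false | ih = s≤s ih
  ... | false | true  | ih = ≤-trans (s≤s ih) (≤-reflexive (sym (+-suc _ _)))
  ... | false | false | ih = ih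

  countB-≤-+ : ∀ {P Q R : A → Bool} (xs : List A) →
               (∀ {x} → x ∈ xs → P x ≡ true → Q x ≡ true ⊎ R x ≡ true) →
               countB P xs ≤ countB Q xs + countB R xs
  countB-≤-+ {P} {Q} {R} xs P⇒Q∨R = ≤-trans (countB-mono xs P⇒Q∨R′) (countB-∨ Q R xs)
    where
    P⇒Q∨R′ : ∀ {x} → x ∈ xs → P x ≡ true → Q x ∨ R x ≡ true
    P⇒Q∨R′ x∈xs Px with P⇒Q∨R x∈xs Px
    ... | inj₁ Qx rewrite Qx = refl
    ... | inj₂ Rx rewrite Rx = ∨-zeroʳ (Q _)

  countB-< : ∀ {P Q : A → Bool} (xs : List A) {a} → a ∈ xs → P a ≡ false → Q a ≡ true →
             (∀ {x} → x ∈ xs → P x ≡ true → Q x ≡ true) → countB P xs < countB Q xs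
  countB-< {P} {Q} (x ∷ xs) (here refl) Pa Qa P⇒Q rewrite Pa | Qa = s≤s (countB-mono xs (P⇒Q ∘ there))
  countB-< {P} {Q} (x ∷ xs) (there a∈xs) Pa Qa P⇒Q
    with P x in Px | Q x in Qx | countB-< xs a∈xs Pa Qa (P⇒Q ∘ there)
  ... | true  | true  | ih = s≤s ih
  ... | true  | false | _  = contradictionᵇ (P⇒Q (here refl) Px) Qx
  ... | false | true  | ih = m≤n⇒m≤1+n ih
  ... | false | false | ih = ih

  countB-<⇒Any : ∀ {P Q : A → Bool} (xs : List A) → countB P xs < countB Q xs →
                 Any (λ x → Q x ≡ true × P x ≡ false) xs
  countB-<⇒Any {P} {Q} (x ∷ xs) lt with P x in Px | Q x in Qx
  ... | false | true  = here (Qx , Px)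
  ... | true  | true  = there (countB-<⇒Any xs (≤-pred lt))
  ... | true  | false = there (countB-<⇒Any xs (<-trans (n<1+n _) lt))
  ... | false | false = there (countB-<⇒Any xs lt)

  countB-true : ∀ (xs : List A) → countB (λ _ → true) xs ≡ length xs
  countB-true []       = refl
  countB-true (x ∷ xs) = cong suc (countB-true xs)

  countB-≡0⁺ : ∀ {P : A → Bool} (xs : List A) → (∀ {x} → x ∈ xs → P x ≡ false) → countB P xs ≡ 0
  countB-≡0⁺ []       ¬P = refl
  countB-≡0⁺ (x ∷ xs) ¬P rewrite ¬P (here refl) = countB-≡0⁺ xs (¬P ∘ there)

  countB-split : ∀ (P Q : A → Bool) (xs : List A) →
                 countB (λ x → P x ∧ Q x) xs + countB (λ x → P x ∧ not (Q x)) xs ≡ countB P xs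
  countB-split P Q []       = refl
  countB-split P Q (x ∷ xs) with P x | Q x
  ... | true  | true  = cong suc (countB-split P Q xs)
  ... | true  | false = trans (+-suc _ _) (cong suc (countB-split P Q xs))
  ... | false | _     = countB-split P Q xs

discrete-ivt : (g : ℕ → ℕ) {K : ℕ} (B : ℕ) → g 0 < K → K ≤ g B → ∃ λ t → g t < K × K ≤ g (suc t)
discrete-ivt g zero    g0<K K≤g0 = ⊥-elim (<⇒≱ g0<K K≤g0)
discrete-ivt g {K} (suc B) g0<K K≤gB+1 with K ≤? g B
... | yes K≤gB = discrete-ivt g B g0<K K≤gB
... | no  K≰gB = B , ≰⇒> K≰gB , K≤gB+1

<ᵇ-flip : ∀ t a → (t <ᵇ a) ≡ not (a <ᵇ suc t)
<ᵇ-flip zero    zero    = refl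
<ᵇ-flip zero    (suc a) = refl
<ᵇ-flip (suc t) zero    = refl
<ᵇ-flip (suc t) (suc a) = <ᵇ-flip t a

module _ {A : Set} (P : A → Bool) (key : A → ℕ) (xs : List A) where

  countBelow countAbove : ℕ → ℕ
  countBelow t = countB (λ x → P x ∧ (key x <ᵇ t)) xs
  countAbove t = countB (λ x → P x ∧ (t <ᵇ key x)) xs

  countBelow+countAbove : ∀ t → countBelow (suc t) + countAbove t ≡ countB P xs
  countBelow+countAbove t = begin
    countBelow (suc t) + countAbove t
      ≡⟨ cong (countBelow (suc t) +_) (countB-cong xs λ {x} _ → cong (P x ∧_) (<ᵇ-flip t (key x))) ⟩
    countBelow (suc t) + countB (λ x → P x ∧ not (key x <ᵇ suc t)) xs
      ≡⟨ countB-split P (λ x → key x <ᵇ suc t) xs ⟩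
    countB P xs ∎
    where open ≡-Reasoning

  median : ∀ {m B} → (∀ {x} → x ∈ xs → P x ≡ true → key x < B) →
           0 < countB P xs → countB P xs ≤ m + suc m →
           ∃ λ e → e ∈ xs × P e ≡ true × countBelow (key e) ≤ m × countAbove (key e) ≤ m
  median {m} {B} key<B 0<p p≤2m+1 with countB P xs ≤? m
  ... | yes p≤m with find (countB-<⇒Any xs (subst (_< countB P xs) (sym (countB-≡0⁺ xs λ _ → refl)) 0<p))
  ...   | e , e∈xs , Pe , _ = e , e∈xs , Pe , ≤-trans (countB-mono xs (λ _ → proj₁ ∘ ∧-true⁻)) p≤m
                                             , ≤-trans (countB-mono xs (λ _ → proj₁ ∘ ∧-true⁻)) p≤m
  median {m} {B} key<B 0<p p≤2m+1 | no p≰m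
    with discrete-ivt countBelow B (subst (_< suc m) (sym countBelow-0) (s≤s z≤n))
                                   (subst (suc m ≤_) (sym countBelow-B) (≰⇒> p≰m))
    where
    countBelow-0 : countBelow 0 ≡ 0
    countBelow-0 = countB-≡0⁺ xs λ {x} _ → trans (cong (P x ∧_) (<ᵇ-false⁺ {key x} z≤n)) (∧-zeroʳ (P x))
    countBelow-B : countBelow B ≡ countB P xs
    countBelow-B = countB-cong xs below-B
      where
      below-B : ∀ {x} → x ∈ xs → P x ∧ (key x <ᵇ B) ≡ P x
      below-B {x} x∈xs with P x in Px
      ... | true  = <ᵇ-true⁺ (key<B x∈xs Px)
      ... | false = refl
  ... | t , below<m+1 , m<below with find (countB-<⇒Any xs (<-≤-trans below<m+1 m<below))
  ... | e , e∈xs , Pe∧ , ¬Pe∧ =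
    e , e∈xs , Pe , subst (λ u → countBelow u ≤ m) (sym key≡t) (≤-pred below<m+1)
                  , subst (λ u → countAbove u ≤ m) (sym key≡t) above≤m
    where
    Pe : P e ≡ true
    Pe = proj₁ (∧-true⁻ Pe∧)
    key≡t : key e ≡ t
    key≡t = ≤-antisym (≤-pred (<ᵇ-true⁻ (proj₂ (∧-true⁻ Pe∧)))) (≮⇒≥ λ key<t →
              contradictionᵇ (<ᵇ-true⁺ key<t) (subst (λ b → b ∧ (key e <ᵇ t) ≡ false) Pe ¬Pe∧))
    above≤m : countAbove t ≤ m
    above≤m = +-cancelˡ-≤ (suc m) _ _ (begin
      suc m + countAbove t              ≤⟨ +-monoˡ-≤ _ m<below ⟩
      countBelow (suc t) + countAbove t ≡⟨ countBelow+countAbove t ⟩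
      countB P xs                       ≤⟨ p≤2m+1 ⟩
      m + suc m                         ≡⟨ +-comm m (suc m) ⟩
      suc m + m                         ∎)
      where open ≤-Reasoning

module _ {A : Set} (_⊏_ : A → A → Bool) (⊏-irrefl : ∀ x → (x ⊏ x) ≡ false)
         (⊏-trans : ∀ x y z → (x ⊏ y) ≡ true → (y ⊏ z) ≡ true → (x ⊏ z) ≡ true) where

  maximal : (Q : A → Bool) (xs : List A) →
            (∀ {x} → x ∈ xs → Q x ≡ false) ⊎
            ∃ λ e → e ∈ xs × Q e ≡ true × (∀ {x} → x ∈ xs → Q x ≡ true → (e ⊏ x) ≡ false)
  maximal Q [] = inj₁ λ ()
  maximal Q (y ∷ xs) with maximal Q xs | Q y in Qy
  ... | inj₁ none | false = inj₁ λ { (here refl) → Qy ; (there x∈xs) → none x∈xs }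
  ... | inj₁ none | true  = inj₂ (y , here refl , Qy , λ { (here refl) _ → ⊏-irrefl y
                                                        ; (there x∈xs) Qx → contradictionᵇ Qx (none x∈xs) })
  ... | inj₂ (e , e∈xs , Qe , max) | false =
    inj₂ (e , there e∈xs , Qe , λ { (here refl) Qx → contradictionᵇ Qx Qy ; (there x∈xs) → max x∈xs })
  ... | inj₂ (e , e∈xs , Qe , max) | true with e ⊏ y in e⊏y
  ...   | false = inj₂ (e , there e∈xs , Qe , λ { (here refl) _ → e⊏y ; (there x∈xs) → max x∈xs })
  ...   | true  = inj₂ (y , here refl , Qy , λ { (here refl) _ → ⊏-irrefl y ; (there x∈xs) Qx → y⋢ x∈xs Qx })
    where
    y⋢ : ∀ {x} → x ∈ xs → Q x ≡ true → (y ⊏ x) ≡ false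
    y⋢ {x} x∈xs Qx with y ⊏ x in y⊏x
    ... | false = refl
    ... | true  = contradictionᵇ (⊏-trans e y x e⊏y y⊏x) (max x∈xs Qx)

module OrderFormula where

  infix  7 _<ᶠ_ _≡ᶠ_ _≤ᶠ_
  infix  6 ¬ᶠ_
  infixr 5 _∧ᶠ_
  infixr 4 _∨ᶠ_ _xorᶠ_
  infixr 3 _⇒ᶠ_

  mutual
    data Term (m : ℕ) : Set where
      var : Fin m → Term m
      ite : Formula m → Term m → Term m → Term m

    data Formula (m : ℕ) : Set where
      _<ᶠ_ _≡ᶠ_            : Term m → Term m → Formula m
      ¬ᶠ_                  : Formula m → Formula m
      _∧ᶠ_ _∨ᶠ_ _xorᶠ_     : Formula m → Formula m → Formula m

  _≤ᶠ_ : ∀ {m} → Term m → Term m → Formula m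
  t ≤ᶠ u = ¬ᶠ u <ᶠ t

  _⇒ᶠ_ : ∀ {m} → Formula m → Formula m → Formula m
  φ ⇒ᶠ ψ = ¬ᶠ φ ∨ᶠ ψ

  mutual
    ⟦_⟧ᵗ : ∀ {m} → Term m → Vec ℕ m → ℕ
    ⟦ var a     ⟧ᵗ ρ = lookup ρ a
    ⟦ ite φ t u ⟧ᵗ ρ = if ⟦ φ ⟧ ρ then ⟦ t ⟧ᵗ ρ else ⟦ u ⟧ᵗ ρ

    ⟦_⟧ : ∀ {m} → Formula m → Vec ℕ m → Bool
    ⟦ t <ᶠ u   ⟧ ρ = ⟦ t ⟧ᵗ ρ <ᵇ ⟦ u ⟧ᵗ ρ
    ⟦ t ≡ᶠ u   ⟧ ρ = ⟦ t ⟧ᵗ ρ ≡ᵇ ⟦ u ⟧ᵗ ρ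
    ⟦ ¬ᶠ φ     ⟧ ρ = not (⟦ φ ⟧ ρ)
    ⟦ φ ∧ᶠ ψ   ⟧ ρ = ⟦ φ ⟧ ρ ∧ ⟦ ψ ⟧ ρ
    ⟦ φ ∨ᶠ ψ   ⟧ ρ = ⟦ φ ⟧ ρ ∨ ⟦ ψ ⟧ ρ
    ⟦ φ xorᶠ ψ ⟧ ρ = xorB (⟦ φ ⟧ ρ) (⟦ ψ ⟧ ρ)

  module _ {m} {ρ σ : Vec ℕ m}
           (<ᵇ-agree : ∀ a b → (lookup ρ a <ᵇ lookup ρ b) ≡ (lookup σ a <ᵇ lookup σ b))
           (≡ᵇ-agree : ∀ a b → (lookup ρ a ≡ᵇ lookup ρ b) ≡ (lookup σ a ≡ᵇ lookup σ b)) where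

    mutual
      ⟦⟧ᵗ-var : ∀ t → ∃ λ a → ⟦ t ⟧ᵗ ρ ≡ lookup ρ a × ⟦ t ⟧ᵗ σ ≡ lookup σ a
      ⟦⟧ᵗ-var (var a) = a , refl , refl
      ⟦⟧ᵗ-var (ite φ t u) with ⟦ φ ⟧ ρ | ⟦ φ ⟧ σ | ⟦⟧-invariant φ
      ... | true  | .true  | refl = ⟦⟧ᵗ-var t
      ... | false | .false | refl = ⟦⟧ᵗ-var u

      ⟦⟧-invariant : ∀ φ → ⟦ φ ⟧ ρ ≡ ⟦ φ ⟧ σ
      ⟦⟧-invariant (t <ᶠ u)   = compare _<ᵇ_ <ᵇ-agree t u
      ⟦⟧-invariant (t ≡ᶠ u)   = compare _≡ᵇ_ ≡ᵇ-agree t u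
      ⟦⟧-invariant (¬ᶠ φ)     = cong not (⟦⟧-invariant φ)
      ⟦⟧-invariant (φ ∧ᶠ ψ)   = cong₂ _∧_ (⟦⟧-invariant φ) (⟦⟧-invariant ψ)
      ⟦⟧-invariant (φ ∨ᶠ ψ)   = cong₂ _∨_ (⟦⟧-invariant φ) (⟦⟧-invariant ψ)
      ⟦⟧-invariant (φ xorᶠ ψ) = cong₂ xorB (⟦⟧-invariant φ) (⟦⟧-invariant ψ)

      compare : (_≺_ : ℕ → ℕ → Bool) →
                (∀ a b → (lookup ρ a ≺ lookup ρ b) ≡ (lookup σ a ≺ lookup σ b)) → ∀ t u → (⟦ t ⟧ᵗ ρ ≺ ⟦ u ⟧ᵗ ρ) ≡ (⟦ t ⟧ᵗ σ ≺ ⟦ u ⟧ᵗ σ)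
      compare _≺_ agree t u with ⟦⟧ᵗ-var t | ⟦⟧ᵗ-var u
      ... | a , ρt , σt | b , ρu , σu = begin
        ⟦ t ⟧ᵗ ρ ≺ ⟦ u ⟧ᵗ ρ       ≡⟨ cong₂ _≺_ ρt ρu ⟩
        lookup ρ a ≺ lookup ρ b   ≡⟨ agree a b ⟩
        lookup σ a ≺ lookup σ b   ≡⟨ sym (cong₂ _≺_ σt σu) ⟩
        ⟦ t ⟧ᵗ σ ≺ ⟦ u ⟧ᵗ σ       ∎
        where open ≡-Reasoning

  module _ {A : Set} (f g : A → ℕ) (mono : ∀ {a b} → f a < f b → g a < g b)
           (resp : ∀ {a b} → f a ≡ f b → g a ≡ g b) where

    <ᵇ-preserved : ∀ a b → (f a <ᵇ f b) ≡ (g a <ᵇ g b)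
    <ᵇ-preserved a b with <-cmp (f a) (f b)
    ... | tri< lt _ _ = trans (<ᵇ-true⁺ lt) (sym (<ᵇ-true⁺ (mono lt)))
    ... | tri≈ _ eq _ = trans (<ᵇ-false⁺ (≤-reflexive (sym eq))) (sym (<ᵇ-false⁺ (≤-reflexive (sym (resp eq)))))
    ... | tri> _ _ gt = trans (<ᵇ-false⁺ (<⇒≤ gt)) (sym (<ᵇ-false⁺ (<⇒≤ (mono gt))))

    ≡ᵇ-preserved : ∀ a b → (f a ≡ᵇ f b) ≡ (g a ≡ᵇ g b)
    ≡ᵇ-preserved a b with <-cmp (f a) (f b)
    ... | tri< lt _ _ = trans (≡ᵇ-false⁺ (<⇒≢ lt)) (sym (≡ᵇ-false⁺ (<⇒≢ (mono lt))))
    ... | tri≈ _ eq _ = trans (≡ᵇ-true⁺ eq) (sym (≡ᵇ-true⁺ (resp eq)))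
    ... | tri> _ _ gt = trans (≡ᵇ-false⁺ (≢-sym (<⇒≢ gt))) (sym (≡ᵇ-false⁺ (≢-sym (<⇒≢ (mono gt)))))

  -- Ranks realise the order type of ρ by values below m, so checking assignments into Fin m suffices.
  module Rank {m} (ρ : Vec ℕ m) where

    rank : Fin m → ℕ
    rank a = countB (λ b → lookup ρ b <ᵇ lookup ρ a) (allFin m)

    rank<m : ∀ a → rank a < m
    rank<m a = subst (rank a <_) (length-tabulate id)
      (subst (rank a <_) (countB-true (allFin m))
        (countB-< (allFin m) (∈-allFin a) (<ᵇ-false⁺ {lookup ρ a} ≤-refl) refl (λ _ _ → refl)))

    rank-mono : ∀ {a b} → lookup ρ a < lookup ρ b → rank a < rank b
    rank-mono {a} {b} lt = countB-< (allFin m) (∈-allFin a) (<ᵇ-false⁺ {lookup ρ a} ≤-refl) (<ᵇ-true⁺ lt)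
                                    (λ _ c<a → <ᵇ-true⁺ (<-trans (<ᵇ-true⁻ c<a) lt))

    rank-resp : ∀ {a b} → lookup ρ a ≡ lookup ρ b → rank a ≡ rank b
    rank-resp eq = countB-cong (allFin m) λ {c} _ → cong (lookup ρ c <ᵇ_) eq

    ranks : Vec (Fin m) m
    ranks = tabulate λ a → fromℕ< (rank<m a)

    lookup-ranks : ∀ a → lookup (Vec.map toℕ ranks) a ≡ rank a
    lookup-ranks a = begin
      lookup (Vec.map toℕ ranks) a ≡⟨ lookup-map a toℕ ranks ⟩
      toℕ (lookup ranks a)         ≡⟨ cong toℕ (lookup∘tabulate _ a) ⟩
      toℕ (fromℕ< (rank<m a))      ≡⟨ toℕ-fromℕ< (rank<m a) ⟩
      rank a                       ∎
      where open ≡-Reasoning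

    ⟦⟧-ranks : ∀ φ → ⟦ φ ⟧ ρ ≡ ⟦ φ ⟧ (Vec.map toℕ ranks)
    ⟦⟧-ranks = ⟦⟧-invariant
      (λ a b → trans (<ᵇ-preserved (lookup ρ) rank rank-mono rank-resp a b)
                     (sym (cong₂ _<ᵇ_ (lookup-ranks a) (lookup-ranks b))))
      (λ a b → trans (≡ᵇ-preserved (lookup ρ) rank rank-mono rank-resp a b)
                     (sym (cong₂ _≡ᵇ_ (lookup-ranks a) (lookup-ranks b))))

  allFinᵇ : ∀ {m} → (Fin m → Bool) → Bool
  allFinᵇ {zero}  p = true
  allFinᵇ {suc m} p = p Fin.zero ∧ allFinᵇ (p ∘ Fin.suc)

  allVecᵇ : ∀ {m} k → (Vec (Fin m) k → Bool) → Bool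
  allVecᵇ zero    p = p []
  allVecᵇ (suc k) p = allFinᵇ λ a → allVecᵇ k (p ∘ (a ∷_))

  allFinᵇ-sound : ∀ {m} (p : Fin m → Bool) → allFinᵇ p ≡ true → ∀ a → p a ≡ true
  allFinᵇ-sound p all Fin.zero    = proj₁ (∧-true⁻ all)
  allFinᵇ-sound p all (Fin.suc a) = allFinᵇ-sound (p ∘ Fin.suc) (proj₂ (∧-true⁻ all)) a

  allVecᵇ-sound : ∀ {m k} (p : Vec (Fin m) k → Bool) → allVecᵇ k p ≡ true → ∀ w → p w ≡ true
  allVecᵇ-sound p all []      = all
  allVecᵇ-sound p all (a ∷ w) = allVecᵇ-sound (p ∘ (a ∷_)) (allFinᵇ-sound _ all a) w

  Valid : ∀ {m} → Formula m → Set
  Valid {m} φ = allVecᵇ {m} m (λ w → ⟦ φ ⟧ (Vec.map toℕ w)) ≡ true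

  valid⇒true : ∀ {m} (φ : Formula m) → Valid φ → ∀ ρ → ⟦ φ ⟧ ρ ≡ true
  valid⇒true φ valid ρ = trans (⟦⟧-ranks φ) (allVecᵇ-sound _ valid ranks)
    where open Rank ρ

  Open : ℕ → ℕ → Set
  Open zero    m = Formula m
  Open (suc k) m = Term m → Open k m

  instantiate : ∀ {k m} → Open k m → Vec (Term m) k → Formula m
  instantiate φ []       = φ
  instantiate φ (t ∷ ts) = instantiate (φ t) ts

  orderFact : ∀ m (φ : Open m m) → Valid (instantiate φ (tabulate var)) →
              ∀ ρ → ⟦ instantiate φ (tabulate var) ⟧ ρ ≡ true
  orderFact m φ = valid⇒true (instantiate φ (tabulate var))

open OrderFormula

between : ℕ → ℕ → ℕ → Bool
between i j t = (i <ᵇ t) ∧ (t <ᵇ j)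

innerEnd : ℕ → ℕ → ℕ → ℕ → ℕ
innerEnd i j c d = if between i j c then c else d

inClosedSpan : ℕ → ℕ → ℕ → Bool
inClosedSpan a b t = (not (t <ᵇ a) ∧ not (b <ᵇ t)) ∨ (not (t <ᵇ b) ∧ not (a <ᵇ t))

nested : ℕ → ℕ → ℕ → ℕ → Bool
nested a b c d =
  inClosedSpan a b c ∧ inClosedSpan a b d ∧ not (c ≡ᵇ d) ∧
  not (((c ≡ᵇ a) ∧ (d ≡ᵇ b)) ∨ ((c ≡ᵇ b) ∧ (d ≡ᵇ a)))

-- Each formula below evaluates, definitionally, to the Boolean function it is named after
-- (strictlyBetween, intertwinedℕ, nested, …), so orderFact proves statements about those functions.
module _ {m : ℕ} where

  StrictlyBetweenᶠ Betweenᶠ InClosedSpanᶠ : Term m → Term m → Term m → Formula m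
  StrictlyBetweenᶠ p q r = (p <ᶠ r ∧ᶠ r <ᶠ q) ∨ᶠ (q <ᶠ r ∧ᶠ r <ᶠ p)
  Betweenᶠ i j t = i <ᶠ t ∧ᶠ t <ᶠ j
  InClosedSpanᶠ a b t = (a ≤ᶠ t ∧ᶠ t ≤ᶠ b) ∨ᶠ (b ≤ᶠ t ∧ᶠ t ≤ᶠ a)

  Intertwinedᶠ Nestedᶠ : Term m → Term m → Term m → Term m → Formula m
  Intertwinedᶠ p q r s =
    (¬ᶠ p ≡ᶠ q ∧ᶠ ¬ᶠ p ≡ᶠ r ∧ᶠ ¬ᶠ p ≡ᶠ s ∧ᶠ ¬ᶠ q ≡ᶠ r ∧ᶠ ¬ᶠ q ≡ᶠ s ∧ᶠ ¬ᶠ r ≡ᶠ s) ∧ᶠ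
    (StrictlyBetweenᶠ p q r xorᶠ StrictlyBetweenᶠ p q s)
  Nestedᶠ a b c d =
    InClosedSpanᶠ a b c ∧ᶠ InClosedSpanᶠ a b d ∧ᶠ ¬ᶠ c ≡ᶠ d ∧ᶠ
    ¬ᶠ ((c ≡ᶠ a ∧ᶠ d ≡ᶠ b) ∨ᶠ (c ≡ᶠ b ∧ᶠ d ≡ᶠ a))

  InnerEndᶠ : Term m → Term m → Term m → Term m → Term m
  InnerEndᶠ i j c d = ite (Betweenᶠ i j c) c d

not-<ᵇ⁺ : ∀ {m n} → m ≤ n → not (n <ᵇ m) ≡ true
not-<ᵇ⁺ m≤n = cong not (<ᵇ-false⁺ m≤n)

between⁻ : ∀ {i j t} → between i j t ≡ true → i < t × t < j
between⁻ {i} {j} {t} h =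
  let i<t , t<j = ∧-true⁻ {i <ᵇ t} h in <ᵇ-true⁻ {i} {t} i<t , <ᵇ-true⁻ {t} {j} t<j

strictlyBetween-suc : ∀ a t → strictlyBetween a (suc a) t ≡ false
strictlyBetween-suc a t with a <ᵇ t in a<t | suc a <ᵇ t in a+1<t
... | false | false = refl
... | false | true  = contradictionᵇ (<ᵇ-true⁺ (<-trans (n<1+n a) (<ᵇ-true⁻ {suc a} {t} a+1<t))) a<t
... | true  | _ rewrite <ᵇ-false⁺ {t} {suc a} (<ᵇ-true⁻ {a} {t} a<t)
                    | <ᵇ-false⁺ {t} {a} (<⇒≤ (<ᵇ-true⁻ {a} {t} a<t)) = ∧-zeroʳ _

intertwined-suc : ∀ a r s → intertwinedℕ a (suc a) r s ≡ false
intertwined-suc a r s rewrite strictlyBetween-suc a r | strictlyBetween-suc a s = ∧-zeroʳ _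

intertwined-inside : ∀ {i j r s} → i ≤ r → r ≤ j → i ≤ s → s ≤ j →
                     intertwinedℕ i j r s ≡ false × intertwinedℕ j i r s ≡ false
intertwined-inside {i} {j} {r} {s} i≤r r≤j i≤s s≤j =
  let ¬ij , ¬ji = ∧-true⁻ (⇒-elim
        (orderFact 4 (λ i j r s → i ≤ᶠ r ∧ᶠ r ≤ᶠ j ∧ᶠ i ≤ᶠ s ∧ᶠ s ≤ᶠ j ⇒ᶠ
                                   ¬ᶠ Intertwinedᶠ i j r s ∧ᶠ ¬ᶠ Intertwinedᶠ j i r s)
                   refl (i ∷ j ∷ r ∷ s ∷ []))
        (∧-intro (not-<ᵇ⁺ i≤r) (∧-intro (not-<ᵇ⁺ r≤j) (∧-intro (not-<ᵇ⁺ i≤s) (not-<ᵇ⁺ s≤j)))))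
  in not-true⁻ ¬ij , not-true⁻ ¬ji

intertwined-disjoint : ∀ {p q p′ q′} → p < q → q ≤ p′ → p′ < q′ → intertwinedℕ p q p′ q′ ≡ false
intertwined-disjoint {p} {q} {p′} {q′} p<q q≤p′ p′<q′ = not-true⁻ (⇒-elim
  (orderFact 4 (λ p q p′ q′ → p <ᶠ q ∧ᶠ q ≤ᶠ p′ ∧ᶠ p′ <ᶠ q′ ⇒ᶠ ¬ᶠ Intertwinedᶠ p q p′ q′)
             refl (p ∷ q ∷ p′ ∷ q′ ∷ []))
  (∧-intro (<ᵇ-true⁺ p<q) (∧-intro (not-<ᵇ⁺ q≤p′) (<ᵇ-true⁺ p′<q′))))

nested-irrefl : ∀ r s → nested r s r s ≡ false
nested-irrefl r s = not-true⁻ (orderFact 2 (λ r s → ¬ᶠ Nestedᶠ r s r s) refl (r ∷ s ∷ []))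

nested-trans : ∀ {a b c d e f} → nested a b c d ≡ true → nested c d e f ≡ true → nested a b e f ≡ true
nested-trans {a} {b} {c} {d} {e} {f} abcd cdef = ⇒-elim
  (orderFact 6 (λ a b c d e f → Nestedᶠ a b c d ∧ᶠ Nestedᶠ c d e f ⇒ᶠ Nestedᶠ a b e f)
             refl (a ∷ b ∷ c ∷ d ∷ e ∷ f ∷ []))
  (∧-intro abcd cdef)

innerEnd-between : ∀ {i j} c d → i < j → intertwinedℕ i j c d ∨ nested i j c d ≡ true →
                   between i j (innerEnd i j c d) ≡ true
innerEnd-between {i} {j} c d i<j h = ⇒-elim
  (orderFact 4 (λ i j c d → i <ᶠ j ∧ᶠ (Intertwinedᶠ i j c d ∨ᶠ Nestedᶠ i j c d) ⇒ᶠ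
                            Betweenᶠ i j (InnerEndᶠ i j c d))
             refl (i ∷ j ∷ c ∷ d ∷ []))
  (∧-intro (<ᵇ-true⁺ i<j) h)

module _ {i j : ℕ} (c d r s : ℕ) (i<j : i < j) where

  private
    x : ℕ
    x = innerEnd i j c d

  pierced-left : intertwinedℕ i j c d ≡ true → intertwinedℕ i x r s ≡ true →
                 (intertwinedℕ i j r s ∧ (innerEnd i j r s <ᵇ x)) ∨ intertwinedℕ c d r s ≡ true
  pierced-left ijcd ixrs = ⇒-elim
    (orderFact 6 (λ i j c d r s → let x = InnerEndᶠ i j c d in
                    i <ᶠ j ∧ᶠ Intertwinedᶠ i j c d ∧ᶠ Intertwinedᶠ i x r s ⇒ᶠ
                    (Intertwinedᶠ i j r s ∧ᶠ InnerEndᶠ i j r s <ᶠ x) ∨ᶠ Intertwinedᶠ c d r s)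
               refl (i ∷ j ∷ c ∷ d ∷ r ∷ s ∷ []))
    (∧-intro (<ᵇ-true⁺ i<j) (∧-intro ijcd ixrs))

  pierced-right : intertwinedℕ i j c d ≡ true → intertwinedℕ x j r s ≡ true →
                  (intertwinedℕ i j r s ∧ (x <ᵇ innerEnd i j r s)) ∨ intertwinedℕ c d r s ≡ true
  pierced-right ijcd xjrs = ⇒-elim
    (orderFact 6 (λ i j c d r s → let x = InnerEndᶠ i j c d in
                    i <ᶠ j ∧ᶠ Intertwinedᶠ i j c d ∧ᶠ Intertwinedᶠ x j r s ⇒ᶠ
                    (Intertwinedᶠ i j r s ∧ᶠ x <ᶠ InnerEndᶠ i j r s) ∨ᶠ Intertwinedᶠ c d r s)
               refl (i ∷ j ∷ c ∷ d ∷ r ∷ s ∷ []))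
    (∧-intro (<ᵇ-true⁺ i<j) (∧-intro ijcd xjrs))

  nested-left : nested i j c d ≡ true → intertwinedℕ i x r s ≡ true →
                intertwinedℕ i j r s ∨ intertwinedℕ c d r s ∨ (nested i j r s ∧ nested r s c d) ≡ true
  nested-left ijcd ixrs = ⇒-elim
    (orderFact 6 (λ i j c d r s → let x = InnerEndᶠ i j c d in
                    i <ᶠ j ∧ᶠ Nestedᶠ i j c d ∧ᶠ Intertwinedᶠ i x r s ⇒ᶠ
                    Intertwinedᶠ i j r s ∨ᶠ Intertwinedᶠ c d r s ∨ᶠ (Nestedᶠ i j r s ∧ᶠ Nestedᶠ r s c d))
               refl (i ∷ j ∷ c ∷ d ∷ r ∷ s ∷ []))
    (∧-intro (<ᵇ-true⁺ i<j) (∧-intro ijcd ixrs))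

  nested-right : nested i j c d ≡ true → intertwinedℕ x j r s ≡ true →
                 intertwinedℕ i j r s ∨ intertwinedℕ c d r s ∨ (nested i j r s ∧ nested r s c d) ≡ true
  nested-right ijcd xjrs = ⇒-elim
    (orderFact 6 (λ i j c d r s → let x = InnerEndᶠ i j c d in
                    i <ᶠ j ∧ᶠ Nestedᶠ i j c d ∧ᶠ Intertwinedᶠ x j r s ⇒ᶠ
                    Intertwinedᶠ i j r s ∨ᶠ Intertwinedᶠ c d r s ∨ᶠ (Nestedᶠ i j r s ∧ᶠ Nestedᶠ r s c d))
               refl (i ∷ j ∷ c ∷ d ∷ r ∷ s ∷ []))
    (∧-intro (<ᵇ-true⁺ i<j) (∧-intro ijcd xjrs))

pierces-inner-right : ∀ {i j x} r s → i < x → x < j → intertwinedℕ x j r s ≡ true →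
                      intertwinedℕ i j r s ∨ nested i j r s ≡ true
pierces-inner-right {i} {j} {x} r s i<x x<j xjrs = ⇒-elim
  (orderFact 5 (λ i j x r s → Betweenᶠ i j x ∧ᶠ Intertwinedᶠ x j r s ⇒ᶠ
                              Intertwinedᶠ i j r s ∨ᶠ Nestedᶠ i j r s)
             refl (i ∷ j ∷ x ∷ r ∷ s ∷ []))
  (∧-intro (∧-intro (<ᵇ-true⁺ i<x) (<ᵇ-true⁺ x<j)) xjrs)

Splitting : (ℕ → ℕ → Set) → ℕ → ℕ → Set
Splitting Light i j = ∃ λ x → i < x × x < j × Light i x × Light x j

_⊏_ : ℕ × ℕ → ℕ × ℕ → Bool
(c , d) ⊏ (r , s) = nested r s c d

⊏-irrefl : ∀ x → (x ⊏ x) ≡ false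
⊏-irrefl (r , s) = nested-irrefl r s

⊏-trans : ∀ x y z → (x ⊏ y) ≡ true → (y ⊏ z) ≡ true → (x ⊏ z) ≡ true
⊏-trans (e , f) (c , d) (a , b) x⊏y y⊏z = nested-trans {a} {b} {c} {d} {e} {f} y⊏z x⊏y

module Chords (C : List (ℕ × ℕ)) where

  pierces : ℕ → ℕ → ℕ × ℕ → Bool
  pierces a b (r , s) = intertwinedℕ a b r s

  pierceCount : ℕ → ℕ → ℕ
  pierceCount a b = countB (pierces a b) C

  pierceCount-suc : ∀ a → pierceCount a (suc a) ≡ 0
  pierceCount-suc a = countB-≡0⁺ C λ {(r , s)} _ → intertwined-suc a r s

  pierceCount-hull : ∀ {m} → All (λ (r , s) → r ≤ m × s ≤ m) C → pierceCount 0 m ≡ 0 × pierceCount m 0 ≡ 0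
  pierceCount-hull {m} bounded = countB-≡0⁺ C (proj₁ ∘ unpierced) , countB-≡0⁺ C (proj₂ ∘ unpierced)
    where
    unpierced : ∀ {rs} → rs ∈ C → pierces 0 m rs ≡ false × pierces m 0 rs ≡ false
    unpierced rs∈C = let r≤m , s≤m = All.lookup bounded rs∈C in intertwined-inside z≤n r≤m z≤n s≤m

  module _ (k : ℕ) (planar : All (λ (r , s) → pierceCount r s ≤ suc k) C) where

    Light : ℕ → ℕ → Set
    Light a b = pierceCount a b ≤ k + suc k

    innerEndOf : ℕ → ℕ → ℕ × ℕ → ℕ
    innerEndOf i j (c , d) = innerEnd i j c d

    split-pierced : ∀ {i j} → i < j → 0 < pierceCount i j → Light i j → Splitting Light i j
    split-pierced {i} {j} i<j pierced light
      with median (pierces i j) (innerEndOf i j) C {B = j}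
                  (λ { {c , d} _ ijcd → proj₂ (between⁻ (innerEnd-between c d i<j (∨-introˡ ijcd))) })
                  pierced light
    ... | (c , d) , cd∈C , ijcd , below≤k , above≤k =
      x , proj₁ i<x<j , proj₂ i<x<j ,
      ≤-trans (countB-≤-+ C left) (+-mono-≤ below≤k (All.lookup planar cd∈C)) ,
      ≤-trans (countB-≤-+ C right) (+-mono-≤ above≤k (All.lookup planar cd∈C))
      where
      x : ℕ
      x = innerEnd i j c d
      i<x<j : i < x × x < j
      i<x<j = between⁻ (innerEnd-between c d i<j (∨-introˡ ijcd))
      left : ∀ {f} → f ∈ C → pierces i x f ≡ true →
             (pierces i j f ∧ (innerEndOf i j f <ᵇ x)) ≡ true ⊎ pierces c d f ≡ true
      left {r , s} _ ixrs = ∨-true⁻ (pierced-left c d r s i<j ijcd ixrs)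
      right : ∀ {f} → f ∈ C → pierces x j f ≡ true →
              (pierces i j f ∧ (x <ᵇ innerEndOf i j f)) ≡ true ⊎ pierces c d f ≡ true
      right {r , s} _ xjrs = ∨-true⁻ (pierced-right c d r s i<j ijcd xjrs)

    split-unpierced : ∀ {i j} → suc i < j → pierceCount i j ≡ 0 → Splitting Light i j
    split-unpierced {i} {j} i+1<j unpierced with maximal _⊏_ ⊏-irrefl ⊏-trans (λ (r , s) → nested i j r s) C
    ... | inj₁ none =
      suc i , ≤-refl , i+1<j , ≤-trans (≤-reflexive (pierceCount-suc i)) z≤n ,
      ≤-trans (countB-mono C cover) (≤-trans (≤-reflexive unpierced) z≤n)
      where
      cover : ∀ {f} → f ∈ C → pierces (suc i) j f ≡ true → pierces i j f ≡ true
      cover {r , s} rs∈C h with ∨-true⁻ (pierces-inner-right r s ≤-refl i+1<j h)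
      ... | inj₁ ijrs   = ijrs
      ... | inj₂ ijrs-nested = contradictionᵇ ijrs-nested (none rs∈C)
    ... | inj₂ ((c , d) , cd∈C , ijcd , maximum) =
      x , proj₁ i<x<j , proj₂ i<x<j , bounded left , bounded right
      where
      i<j : i < j
      i<j = <-trans (n<1+n i) i+1<j
      x : ℕ
      x = innerEnd i j c d
      i<x<j : i < x × x < j
      i<x<j = between⁻ (innerEnd-between c d i<j (∨-introʳ ijcd))

      bounded : ∀ {a b} → (∀ {f} → f ∈ C → pierces a b f ≡ true → pierces i j f ≡ true ⊎ pierces c d f ≡ true) →
                Light a b
      bounded {a} {b} cover = begin
        pierceCount a b                   ≤⟨ countB-≤-+ C cover ⟩
        pierceCount i j + pierceCount c d ≡⟨ cong (_+ pierceCount c d) unpierced ⟩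
        pierceCount c d                   ≤⟨ All.lookup planar cd∈C ⟩
        suc k                             ≤⟨ m≤n+m (suc k) k ⟩
        k + suc k                         ∎
        where open ≤-Reasoning

      not-around : ∀ {r s} → (r , s) ∈ C →
                   intertwinedℕ i j r s ∨ intertwinedℕ c d r s ∨ (nested i j r s ∧ nested r s c d) ≡ true →
                   intertwinedℕ i j r s ≡ true ⊎ intertwinedℕ c d r s ≡ true
      not-around {r} {s} rs∈C h with ∨-true⁻ h
      ... | inj₁ ijrs = inj₁ ijrs
      ... | inj₂ h′ with ∨-true⁻ h′
      ...   | inj₁ cdrs   = inj₂ cdrs
      ...   | inj₂ around = let ijrs , rscd = ∧-true⁻ {nested i j r s} around in
                            contradictionᵇ rscd (maximum rs∈C ijrs)

      left : ∀ {f} → f ∈ C → pierces i x f ≡ true → pierces i j f ≡ true ⊎ pierces c d f ≡ true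
      left {r , s} rs∈C ixrs = not-around rs∈C (nested-left c d r s i<j ijcd ixrs)

      right : ∀ {f} → f ∈ C → pierces x j f ≡ true → pierces i j f ≡ true ⊎ pierces c d f ≡ true
      right {r , s} rs∈C xjrs = not-around rs∈C (nested-right c d r s i<j ijcd xjrs)

    split : ∀ {i j} → suc i < j → Light i j → Splitting Light i j
    split {i} {j} i+1<j light with pierceCount i j ≟ 0
    ... | yes unpierced = split-unpierced i+1<j unpierced
    ... | no  pierced   = split-pierced (<-trans (n<1+n i) i+1<j) (n≢0⇒n>0 pierced) light

interior-size : ∀ {i x j} → i < x → x < j → (x ∸ suc i) + (j ∸ suc x) ≡ j ∸ suc (suc i)
interior-size {zero}  (s≤s z≤n) (s≤s (s≤s x≤j)) = m+[n∸m]≡n x≤j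
interior-size {suc i} (s≤s i<x) (s≤s x<j)       = interior-size i<x x<j

module Triangulate (Light : ℕ → ℕ → Set)
                   (split : ∀ {i j} → suc i < j → Light i j → Splitting Light i j) where

  module _ {n : ℕ} where

    Inside : ℕ → ℕ → Link n → Set
    Inside i j (p , q) = i ≤ toℕ p × suc (toℕ p) < toℕ q × toℕ q ≤ j

    Proper : ℕ → ℕ → Link n → Set
    Proper i j l = Inside i j l × (i < toℕ (proj₁ l) ⊎ toℕ (proj₂ l) < j)

    Compatible : Link n → Link n → Set
    Compatible l m = l ≢ m × intertwined (proj₁ l) (proj₂ l) (proj₁ m) (proj₂ m) ≡ false

    LightLink : Link n → Set
    LightLink (p , q) = Light (toℕ p) (toℕ q)

    record Diagonals (P : Link n → Set) (size : ℕ) : Set where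
      field
        diagonals  : List (Link n)
        count      : length diagonals ≡ size
        placed     : All P diagonals
        compatible : AllPairs Compatible diagonals
        light      : All LightLink diagonals

    none : ∀ {P size} → size ≡ 0 → Diagonals P size
    none size≡0 = record { diagonals = [] ; count = sym size≡0 ; placed = [] ; compatible = [] ; light = [] }

    disjoint-compatible : ∀ {i x j l m} → Inside i x l → Inside x j m → Compatible l m
    disjoint-compatible {l = p , q} {m = p′ , q′} (_ , p+1<q , q≤x) (x≤p′ , p′+1<q′ , _) =
      l≢m , intertwined-disjoint p<q q≤p′ (<-trans (n<1+n _) p′+1<q′)
      where
      p<q : toℕ p < toℕ q
      p<q = <-trans (n<1+n _) p+1<q
      q≤p′ : toℕ q ≤ toℕ p′
      q≤p′ = ≤-trans q≤x x≤p′
      l≢m : (p , q) ≢ (p′ , q′)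
      l≢m refl = <⇒≱ p<q q≤p′

    enclosing-compatible : ∀ {i j : Fin n} {l} → Proper (toℕ i) (toℕ j) l → Compatible (i , j) l
    enclosing-compatible {i} {j} {p , q} ((i≤p , p+1<q , q≤j) , strict) =
      ij≢pq strict , proj₁ (intertwined-inside i≤p (<⇒≤ (<-≤-trans p<q q≤j)) (≤-trans i≤p (<⇒≤ p<q)) q≤j)
      where
      p<q : toℕ p < toℕ q
      p<q = <-trans (n<1+n _) p+1<q
      ij≢pq : toℕ i < toℕ p ⊎ toℕ q < toℕ j → (i , j) ≢ (p , q)
      ij≢pq (inj₁ i<p) refl = <-irrefl refl i<p
      ij≢pq (inj₂ q<j) refl = <-irrefl refl q<j

    juxtapose : ∀ {i x j a b} → i < x → x < j →
                Diagonals (Inside i x) a → Diagonals (Inside x j) b → Diagonals (Proper i j) (a + b)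
    juxtapose {i} {x} {j} i<x x<j L R = record
      { diagonals  = L.diagonals ++ R.diagonals
      ; count      = trans (length-++ L.diagonals) (cong₂ _+_ L.count R.count)
      ; placed     = ++⁺ (All.map left L.placed) (All.map right R.placed)
      ; compatible = AllPairs.++⁺ L.compatible R.compatible
                       (All.map (λ l∈L → All.map (disjoint-compatible l∈L) R.placed) L.placed)
      ; light      = ++⁺ L.light R.light
      }
      where
      module L = Diagonals L
      module R = Diagonals R
      left : ∀ {l} → Inside i x l → Proper i j l
      left (i≤p , p+1<q , q≤x) = (i≤p , p+1<q , ≤-trans q≤x (<⇒≤ x<j)) , inj₂ (≤-<-trans q≤x x<j)
      right : ∀ {l} → Inside x j l → Proper i j l
      right (x≤p , p+1<q , q≤j) = (≤-trans (<⇒≤ i<x) x≤p , p+1<q , q≤j) , inj₁ (<-≤-trans i<x x≤p)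

    enclose : ∀ {i j : Fin n} {a} → suc (toℕ i) < toℕ j → Light (toℕ i) (toℕ j) →
              Diagonals (Proper (toℕ i) (toℕ j)) a → Diagonals (Inside (toℕ i) (toℕ j)) (suc a)
    enclose {i} {j} i+1<j light D = record
      { diagonals  = (i , j) ∷ D.diagonals
      ; count      = cong suc D.count
      ; placed     = (≤-refl , i+1<j , ≤-refl) ∷ All.map proj₁ D.placed
      ; compatible = All.map enclosing-compatible D.placed ∷ D.compatible
      ; light      = light ∷ D.light
      }
      where module D = Diagonals D

    splitAt : (i j : Fin n) → suc (toℕ i) < toℕ j → Light (toℕ i) (toℕ j) →
              ∃ λ (x : Fin n) → toℕ i < toℕ x × toℕ x < toℕ j × Light (toℕ i) (toℕ x) × Light (toℕ x) (toℕ j)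
    splitAt i j i+1<j light with split i+1<j light
    ... | x , split-x =
      fromℕ< x<n , subst (λ y → toℕ i < y × y < toℕ j × Light (toℕ i) y × Light y (toℕ j))
                         (sym (toℕ-fromℕ< x<n)) split-x
      where x<n = <-trans (proj₁ (proj₂ split-x)) (toℕ<n j)

    rooted : (i j : Fin n) → toℕ i < toℕ j → Light (toℕ i) (toℕ j) →
             Diagonals (Proper (toℕ i) (toℕ j)) (toℕ j ∸ suc (suc (toℕ i))) →
             Diagonals (Inside (toℕ i) (toℕ j)) (toℕ j ∸ suc (toℕ i))
    rooted i j i<j light D with suc (toℕ i) <? toℕ j
    ... | no  i+1≮j = none (m≤n⇒m∸n≡0 (≮⇒≥ i+1≮j))
    ... | yes i+1<j = subst (Diagonals _) (sym (+-∸-assoc 1 i+1<j)) (enclose i+1<j light D)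

    interior : (i j : Fin n) → toℕ i < toℕ j → Light (toℕ i) (toℕ j) → Acc _<_ (toℕ j ∸ toℕ i) →
               Diagonals (Proper (toℕ i) (toℕ j)) (toℕ j ∸ suc (suc (toℕ i)))
    interior i j i<j light (acc smaller) with suc (toℕ i) <? toℕ j
    ... | no  i+1≮j = none (m≤n⇒m∸n≡0 (m≤n⇒m≤1+n (≮⇒≥ i+1≮j)))
    ... | yes i+1<j with splitAt i j i+1<j light
    ... | x , i<x , x<j , ix , xj =
      subst (Diagonals _) (interior-size i<x x<j)
        (juxtapose i<x x<j
          (rooted i x i<x ix (interior i x i<x ix (smaller (∸-monoˡ-< x<j (<⇒≤ i<x)))))
          (rooted x j x<j xj (interior x j x<j xj (smaller (∸-monoʳ-< i<x (<⇒≤ x<j))))))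

  nonConsecutive : ∀ {m} {p q : Fin (suc (suc m))} → Proper 0 (suc m) (p , q) → consecutive p q ≡ false
  nonConsecutive {m} {p} {q} ((_ , p+1<q , q≤m+1) , strict) = cong₂ _∨_ e₁ (cong₂ _∨_ e₂ (cong₂ _∨_ e₃ e₄))
    where
    e₁ : (suc (toℕ p) ≡ᵇ toℕ q) ≡ false
    e₁ = ≡ᵇ-false⁺ (<⇒≢ p+1<q)
    e₂ : (suc (toℕ q) ≡ᵇ toℕ p) ≡ false
    e₂ = ≡ᵇ-false⁺ (≢-sym (<⇒≢ (<-trans (n<1+n _) (m<n⇒m<1+n p+1<q))))
    e₃ : ((suc (toℕ p) ≡ᵇ suc (suc m)) ∧ (toℕ q ≡ᵇ 0)) ≡ false
    e₃ = cong (_∧ (toℕ q ≡ᵇ 0)) (≡ᵇ-false⁺ {suc (toℕ p)} (<⇒≢ (<-≤-trans p+1<q (m≤n⇒m≤1+n q≤m+1))))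
    e₄ : ((suc (toℕ q) ≡ᵇ suc (suc m)) ∧ (toℕ p ≡ᵇ 0)) ≡ false
    e₄ = last-clause strict
      where
      last-clause : 0 < toℕ p ⊎ toℕ q < suc m → ((suc (toℕ q) ≡ᵇ suc (suc m)) ∧ (toℕ p ≡ᵇ 0)) ≡ false
      last-clause (inj₁ 0<p)   = trans (cong ((suc (toℕ q) ≡ᵇ suc (suc m)) ∧_) (≡ᵇ-false⁺ (≢-sym (<⇒≢ 0<p))))
                                       (∧-zeroʳ _)
      last-clause (inj₂ q<m+1) = cong (_∧ (toℕ p ≡ᵇ 0)) (≡ᵇ-false⁺ {suc (toℕ q)} (<⇒≢ (s≤s q<m+1)))

  noDiagonals : ∀ {n} → n ∸ 3 ≡ 0 → Triangulation n
  noDiagonals n∸3≡0 = record { innerLinks = [] ; count-inner = sym n∸3≡0 ; distinct = [] ; ordered = []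
                             ; nonConsec = [] ; nonCrossing = [] }

  triangulation : ∀ n → Light 0 (n ∸ 1) → ∃ λ (T : Triangulation n) → All LightLink (innerLinks T)
  triangulation 0             _     = noDiagonals refl , []
  triangulation 1             _     = noDiagonals refl , []
  triangulation (suc (suc m)) light = T , D.light
    where
    last = Fin.fromℕ (suc m)
    last≡ : toℕ last ≡ suc m
    last≡ = toℕ-fromℕ (suc m)
    D : Diagonals (Proper 0 (suc m)) (m ∸ 1)
    D = subst₂ (λ t → Diagonals {suc (suc m)} (Proper 0 t)) last≡ (cong (_∸ 2) last≡)
          (interior Fin.zero last (subst (0 <_) (sym last≡) (s≤s z≤n))
                    (subst (Light 0) (sym last≡) light) (<-wellFounded _))
    module D = Diagonals D
    T : Triangulation (suc (suc m))
    T = record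
      { innerLinks  = D.diagonals
      ; count-inner = D.count
      ; distinct    = AllPairs.map proj₁ D.compatible
      ; ordered     = All.map (λ ((_ , p+1<q , _) , _) → <-trans (n<1+n _) p+1<q) D.placed
      ; nonConsec   = All.map nonConsecutive D.placed
      ; nonCrossing = AllPairs.map proj₂ D.compatible
      }

toℕ-nextPos : ∀ {n} (i : Fin n) → toℕ (nextPos i) ≡ suc (toℕ i) ⊎ (toℕ (nextPos i) ≡ 0 × suc (toℕ i) ≡ n)
toℕ-nextPos {suc m} i with toℕ i <? m
... | yes i<m = inj₁ (toℕ-fromℕ< (s≤s i<m))
... | no  i≮m = inj₂ (refl , cong suc (≤-antisym (≤-pred (toℕ<n i)) (≮⇒≥ i≮m)))

position : ∀ {n} → Drawing n → Fin n → ℕ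
position π v = toℕ (π ⟨$⟩ʳ v)

module _ {n : ℕ} (E : Adj n) (π : Drawing n) where

  chords : List (Fin n × Fin n) → List (ℕ × ℕ)
  chords []              = []
  chords ((u , v) ∷ uvs) = if E u v then (position π u , position π v) ∷ chords uvs else chords uvs

  countB-chords : ∀ (P : ℕ × ℕ → Bool) uvs →
                  countB (λ (u , v) → E u v ∧ P (position π u , position π v)) uvs ≡ countB P (chords uvs)
  countB-chords P []              = refl
  countB-chords P ((u , v) ∷ uvs) with E u v
  ... | true  = cong (λ c → if P (position π u , position π v) then suc c else c) (countB-chords P uvs)
  ... | false = countB-chords P uvs

  All-chords : ∀ {Q : ℕ × ℕ → Set} uvs → (∀ u v → E u v ≡ true → Q (position π u , position π v)) →
               All Q (chords uvs)
  All-chords []              Q-edges = []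
  All-chords ((u , v) ∷ uvs) Q-edges with E u v in Euv
  ... | true  = Q-edges u v Euv ∷ All-chords uvs Q-edges
  ... | false = All-chords uvs Q-edges

  drawnChords : List (ℕ × ℕ)
  drawnChords = chords (orderedPairs n)

  open Chords drawnChords

  piercing-pierceCount : ∀ p q → piercing E π (p , q) ≡ pierceCount (toℕ p) (toℕ q)
  piercing-pierceCount p q = countB-chords (pierces (toℕ p) (toℕ q)) (orderedPairs n)

  drawnChords-planar : ∀ {k} → IsOuterKPlanarDrawing k E π →
                       All (λ (r , s) → pierceCount r s ≤ k) drawnChords
  drawnChords-planar {k} drawing = All-chords (orderedPairs n) λ u v Euv →
    subst (_≤ k) (countB-chords (pierces (position π u) (position π v)) (orderedPairs n)) (drawing u v Euv)

  hull-unpierced : pierceCount 0 (n ∸ 1) ≡ 0 × pierceCount (n ∸ 1) 0 ≡ 0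
  hull-unpierced = pierceCount-hull (All-chords (orderedPairs n) λ u v _ →
                     ∸-monoˡ-≤ 1 (toℕ<n (π ⟨$⟩ʳ u)) , ∸-monoˡ-≤ 1 (toℕ<n (π ⟨$⟩ʳ v)))

  outerLink-unpierced : ∀ i → piercing E π (i , nextPos i) ≡ 0
  outerLink-unpierced i = trans (piercing-pierceCount i (nextPos i)) (unpierced (toℕ-nextPos i))
    where
    unpierced : toℕ (nextPos i) ≡ suc (toℕ i) ⊎ (toℕ (nextPos i) ≡ 0 × suc (toℕ i) ≡ n) →
                pierceCount (toℕ i) (toℕ (nextPos i)) ≡ 0
    unpierced (inj₁ next≡) rewrite next≡ = pierceCount-suc (toℕ i)
    unpierced (inj₂ (next≡ , i+1≡n)) rewrite next≡ =
      subst (λ t → pierceCount t 0 ≡ 0) (cong (_∸ 1) (sym i+1≡n)) (proj₂ hull-unpierced)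

lemma5 : (k : ℕ) → 1 ≤ k → (n : ℕ) → (G : SimpleGraph n) →
         IsMaximalOuterKPlanar k G →
         (π : Drawing n) → IsOuterKPlanarDrawing k (adj G) π →
         ∃ λ (T : Triangulation n) → EdgePiercingAtMost (adj G) π T (2 * k ∸ 1)
lemma5 (suc k) _ n G _ π drawing =
  let T , lights = triangulation n (≤-trans (≤-reflexive (proj₁ (hull-unpierced E π))) z≤n)
  in  T , ++⁺ (All.map⁺ (All.tabulate⁺ outer)) (All.map inner lights)
  where
  E : Adj n
  E = adj G

  open Chords (drawnChords E π)

  planar : All (λ (r , s) → pierceCount r s ≤ suc k) (drawnChords E π)
  planar = drawnChords-planar E π drawing

  open Triangulate (Light k planar) (split k planar)

  outer : ∀ i → piercing E π (i , nextPos i) ≤ 2 * suc k ∸ 1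
  outer i = subst (_≤ 2 * suc k ∸ 1) (sym (outerLink-unpierced E π i)) z≤n

  inner : ∀ {l} → LightLink l → piercing E π l ≤ 2 * suc k ∸ 1
  inner {p , q} light =
    subst₂ _≤_ (sym (piercing-pierceCount E π p q)) (cong (k +_) (sym (+-identityʳ (suc k)))) light
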